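{- $\mathtt{RealTime}_{\mathtt{CA}}\subseteq\mathtt{pred}\text{ - }\mathtt{ESO}\text{ - }\mathtt{HORN}$: every language accepted in real time by a one-dimensional two-way cellular automaton with parallel input, neighborhood $\{ -1,0,1\}$ and output on the first cell is defined by a predecessor Horn formula.
   Context: Word structures: for a finite alphabet $\Sigma$ and a nonempty word $w=w_1\dots w_n\in\Sigma^n$, let $\langle w\rangle=([1,n];(Q_s)_{s\in\Sigma},\mathtt{min},\mathtt{max},\mathtt{suc},\mathtt{pred})$ with $Q_s(i)\iff w_i=s$, $\mathtt{min}(i)\iff i=1$, $\mathtt{max}(i)\iff i=n$, $\mathtt{suc}(i)=i+1$ for $i<n$, $\mathtt{suc}(n)=n$, $\mathtt{pred}(i)=i-1$ for $i>1$, $\mathtt{pred}(1)=1$. For $k\ge0$, $x-k$ denotes $\mathtt{pred}^k(x)$. A formula $\Phi$ defines $\{w\in\Sigma^+:\langle w\rangle\models\Phi\}$. Predecessor Horn formulas: formulas $\Phi=\exists\mathbf{R}\,\forall x\forall y\,\psi(x,y)$ where $\mathbf{R}$ is a finite set of binary predicate symbols and $\psi$ is a finite conjunction of Horn clauses $\delta_1\wedge\dots\wedge\delta_r\to\delta_0$, where $\delta_0$ is $R(x,y)$ with $R\in\mathbf{R}$ or $\bot$, and each $\delta_i$ ($i\ge1$) is one of: $Q_s(x-a)$, $Q_s(y-a)$ ($s\in\Sigma$, $a\ge0$); $U(x-a)$, $\neg U(x-a)$, $U(y-a)$, $\neg U(y-a)$ ($U\in\{\mathtt{min},\mathtt{max}\}$,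 $a\ge0$); $S(x-a,y-b)$ or $S(y-b,x-a)$ ($S\in\mathbf{R}$, $a,b\ge0$). Cellular automata: $(Q,\Sigma,Q_{accept},\mathcal{N},\delta)$ with finite $Q\supseteq\Sigma$, $Q_{accept}\subseteq Q$, neighborhood $\mathcal{N}\subset\mathbb{Z}$, $\delta:Q^{|\mathcal{N}|}\to Q$; state $\langle c,t\rangle=\delta(\langle c+v,t-1\rangle:v\in\mathcal{N})$ for $t>1$. On input $w$ of length $n$, cell $i\in[1,n]$ is in state $w_i$ at time 1 and cells outside $[1,n]$ are permanently in a state $\sharp$. $\mathtt{RealTime}_{\mathtt{CA}}$: languages $L$ for which such a CA with $\mathcal{N}=\{ -1,0,1\}$ exists such that $w\in L$ iff cell 1 is in an accepting state at time $n$. -}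

module Defs where

open import Data.Nat using (ℕ; zero; suc; _∸_; _<_; _<?_)
open import Data.Fin using (Fin; zero; suc; toℕ; fromℕ<; inject₁)
open import Data.Bool using (Bool; true; false)
open import Data.Sum using (_⊎_; inj₁; inj₂)
open import Data.Maybe using (Maybe; just; nothing)
open import Data.List using (List)
open import Data.List.Relation.Unary.All using (All)
open import Data.Product using (Σ; _×_)
open import Data.Empty using (⊥)
open import Relation.Nullary using (¬_; yes; no)
open import Relation.Binary.PropositionalEquality using (_≡_)
open import Function using (_⇔_)

-- Words and word structures
-- Alphabet Σ = Fin k. A nonempty word of length n ≥ 1 is w : Fin n → Fin k;
-- position i : Fin n (0-based) stands for position toℕ i + 1 (1-based).

Word : ℕ → ℕ → Set
Word k n = Fin n → Fin k

predF : ∀ {n} → Fin n → Fin n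
predF zero    = zero
predF (suc i) = inject₁ i

_-ᵖ_ : ∀ {n} → Fin n → ℕ → Fin n
x -ᵖ zero  = x
x -ᵖ suc a = predF (x -ᵖ a)

isMin : ∀ {n} → Fin n → Set
isMin i = toℕ i ≡ 0

isMax : ∀ {n} → Fin n → Set
isMax {n} i = suc (toℕ i) ≡ n

data Var : Set where
  vx vy : Var

data UPred : Set where
  umin umax : UPred

data Atom (k r : ℕ) : Set where
  letter : Fin k → Var → ℕ → Atom k r
  bound  : Bool → UPred → Var → ℕ → Atom k r
  relXY  : Fin r → ℕ → ℕ → Atom k r
  -- S(y - b, x - a)   (arguments: S, a, b)
  relYX  : Fin r → ℕ → ℕ → Atom k r

-- δ₁ ∧ … ∧ δ_m → δ₀, with δ₀ = R(x,y) (just R) or ⊥ (nothing)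
record Clause (k r : ℕ) : Set where
  constructor _⇒_
  field
    body : List (Atom k r)
    head : Maybe (Fin r)

-- Φ = ∃ R_0 … R_{r-1} ∀x ∀y ⋀ clauses
record PredHorn (k : ℕ) : Set where
  field
    nrel    : ℕ
    clauses : List (Clause k nrel)

Interp : ℕ → ℕ → Set
Interp r n = Fin r → Fin n → Fin n → Bool

module _ {k r n : ℕ} (w : Word k n) (ρ : Interp r n) (x y : Fin n) where

  varVal : Var → Fin n
  varVal vx = x
  varVal vy = y

  uSem : UPred → Fin n → Set
  uSem umin = isMin
  uSem umax = isMax

  atomSem : Atom k r → Set
  atomSem (letter s v a)  = w (varVal v -ᵖ a) ≡ s
  atomSem (bound true  U v a) = uSem U (varVal v -ᵖ a)
  atomSem (bound false U v a) = ¬ uSem U (varVal v -ᵖ a)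
  atomSem (relXY S a b) = ρ S (x -ᵖ a) (y -ᵖ b) ≡ true
  atomSem (relYX S a b) = ρ S (y -ᵖ b) (x -ᵖ a) ≡ true

  headSem : Maybe (Fin r) → Set
  headSem nothing  = ⊥
  headSem (just R) = ρ R x y ≡ true

  clauseSem : Clause k r → Set
  clauseSem c = All atomSem (Clause.body c) → headSem (Clause.head c)

_⊨_ : ∀ {k n} → Word k n → PredHorn k → Set
_⊨_ {k} {n} w Φ =
  Σ (Interp (PredHorn.nrel Φ) n) λ ρ →
    (x y : Fin n) → All (clauseSem w ρ x y) (PredHorn.clauses Φ)

-- State set Q = Fin k ⊎ Fin m (so Q ⊇ Σ, the input letters being inj₁),
-- ♯ ∈ Q the state of the cells outside [1,n], Q_accept given by accept.

record CA (k : ℕ) : Set where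
  field
    m      : ℕ
    sharp  : Fin k ⊎ Fin m
    accept : Fin k ⊎ Fin m → Bool
    δ      : Fin k ⊎ Fin m → Fin k ⊎ Fin m → Fin k ⊎ Fin m → Fin k ⊎ Fin m

module _ {k : ℕ} (A : CA k) where
  open CA A

  State : Set
  State = Fin k ⊎ Fin m

  -- configurations: cells indexed by ℕ, cell c (1 ≤ c ≤ n) is a real cell,
  -- cells 0 and > n are outside and permanently ♯.
  Config : Set
  Config = ℕ → State

  initConfig : ∀ {n} → Word k n → Config
  initConfig {n} w zero = sharp
  initConfig {n} w (suc i) with i <? n
  ... | yes i<n = inj₁ (w (fromℕ< i<n))
  ... | no  _   = sharp

  stepConfig : ℕ → Config → Config
  stepConfig n f zero = sharp
  stepConfig n f (suc i) with i <? n
  ... | yes _ = δ (f i) (f (suc i)) (f (suc (suc i)))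
  ... | no  _ = sharp

  -- configuration at time 1 + t
  configAt : ∀ {n} → Word k n → ℕ → Config
  configAt {n} w zero    = initConfig w
  configAt {n} w (suc t) = stepConfig n (configAt w t)

  -- real-time acceptance: cell 1 is in an accepting state at time n
  AcceptsRT : ∀ {n} → Word k n → Set
  AcceptsRT {n} w = accept (configAt w (n ∸ 1) 1) ≡ true

-- A Horn formula can guess the space-time diagram of the automaton, folded into the
-- n × n grid of pairs of positions: the pair (x, y) with x ≤ y carries the state of
-- cell y − x + 1 at time x + 1, so the diagonal runs along cell 1 and the corner
-- (n, n) holds the output. One binary relation per state records this, next to two
-- inductively defined relations x = y and x < y. A transition reads the cells at
-- time x − 1 and positions y − 2, y − 1, y, i.e. at bounded predecessor offsets, so
-- it is a Horn clause. The true diagram is a model, by induction on x every model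
-- contains it, and a goal clause forbids each rejecting state at the corner.
module Submission where

open import Defs
open import Data.Nat using (ℕ; suc)
open import Data.Product using (Σ)
open import Function using (_⇔_)

open import Data.Nat using (zero; _+_; _∸_; _≤_; _<_; z≤n; s≤s; z<s; s<s; _≟_; _<?_; _≤?_)
open import Data.Nat.Properties
  using (+-∸-assoc; m+n∸n≡m; n∸n≡0; m∸n≤m; ∸-monoˡ-≤; pred[m∸n]≡m∸[1+n]; ≤-refl; ≤-reflexive;
         ≤-trans; <⇒≤; n≢0⇒n>0; m<n⇒n≢0; ≤-pred; 0≢1+n; suc-injective; m≤n⇒m<n∨m≡n)
open import Data.Fin using (Fin; zero; suc; toℕ; fromℕ; splitAt; join)
open import Data.Fin using () renaming (_≟_ to _≟ᶠ_)
open import Data.Fin.Properties using (toℕ-inject₁; toℕ<n; toℕ-fromℕ; fromℕ<-toℕ; splitAt-join)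
open import Data.Bool using (true; false; if_then_else_)
open import Data.Sum using (_⊎_; inj₁; inj₂)
open import Data.Sum.Properties using (≡-dec)
open import Data.Maybe using (just; nothing)
open import Data.List using (List; []; _∷_; [_]; _++_; map; concatMap; allFin; cartesianProductWith)
open import Data.List.Relation.Unary.All using (All; []; _∷_; head; lookup; universal)
open import Data.List.Relation.Unary.All.Properties using (concat⁺; concat⁻; map⁺; map⁻)
open import Data.List.Relation.Unary.Any using (here; there)
open import Data.List.Membership.Propositional using (_∈_)
open import Data.List.Membership.Propositional.Properties
  using (∈-map⁺; ∈-++⁺ˡ; ∈-++⁺ʳ; ∈-allFin; ∈-concat⁺′; ∈-cartesianProductWith⁺)
open import Data.Product using (_,_; _×_; proj₂)
open import Data.Empty using (⊥-elim)
open import Relation.Nullary using (Dec; yes; no; does; contradiction)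
open import Relation.Nullary.Decidable using (_×-dec_; dec-true)
open import Relation.Binary.PropositionalEquality
  using (_≡_; _≢_; refl; sym; trans; cong; cong₂; subst; subst₂; module ≡-Reasoning)
open import Function using (mk⇔)

does⇒ : ∀ {P : Set} (p? : Dec P) → does p? ≡ true → P
does⇒ (yes p) _ = p

∸1-injective : ∀ {X Y} → X ≢ 0 → Y ≢ 0 → X ∸ 1 ≡ Y ∸ 1 → X ≡ Y
∸1-injective {zero}          X≢0 _   _ = contradiction refl X≢0
∸1-injective {suc _} {zero}  _   Y≢0 _ = contradiction refl Y≢0
∸1-injective {suc _} {suc _} _   _     = cong suc

∸1-cancel-< : ∀ {X Y} → X ∸ 1 < Y ∸ 1 → X < Y
∸1-cancel-< {zero}  {suc _} _ = z<s
∸1-cancel-< {suc _} {suc _}   = s<s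

toℕ-predF : ∀ {n} (u : Fin n) → toℕ (predF u) ≡ toℕ u ∸ 1
toℕ-predF zero    = refl
toℕ-predF (suc i) = toℕ-inject₁ i

toℕ-[-ᵖ] : ∀ {n} (u : Fin n) a → toℕ (u -ᵖ a) ≡ toℕ u ∸ a
toℕ-[-ᵖ] u zero    = refl
toℕ-[-ᵖ] u (suc a) = begin
  toℕ (predF (u -ᵖ a)) ≡⟨ toℕ-predF (u -ᵖ a) ⟩
  toℕ (u -ᵖ a) ∸ 1     ≡⟨ cong (_∸ 1) (toℕ-[-ᵖ] u a) ⟩
  toℕ u ∸ a ∸ 1        ≡⟨ pred[m∸n]≡m∸[1+n] (toℕ u) a ⟩
  toℕ u ∸ suc a        ∎
  where open ≡-Reasoning

toℕ-[-ᵖ]-≡ : ∀ {n U} {u : Fin n} a → toℕ u ≡ U → toℕ (u -ᵖ a) ≡ U ∸ a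
toℕ-[-ᵖ]-≡ {u = u} a refl = toℕ-[-ᵖ] u a

module SpaceTime {k} (A : CA k) {n} (w : Word k n) where
  open CA A

  configAt-cell0 : ∀ t → configAt A w t 0 ≡ sharp
  configAt-cell0 zero    = refl
  configAt-cell0 (suc t) = refl

  configAt-input : (i : Fin n) → configAt A w 0 (suc (toℕ i)) ≡ inj₁ (w i)
  configAt-input i with toℕ i <? n
  ... | yes i<n = cong (λ j → inj₁ (w j)) (fromℕ<-toℕ i i<n)
  ... | no  i≮n = contradiction (toℕ<n i) i≮n

  configAt-step : ∀ t {i} → i < n →
    configAt A w (suc t) (suc i) ≡
    δ (configAt A w t i) (configAt A w t (suc i)) (configAt A w t (suc (suc i)))
  configAt-step t {i} i<n with i <? n
  ... | yes _   = refl
  ... | no  i≮n = contradiction i<n i≮n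

  -- Cell Y − X + 1 at time X + 1; for X > Y the truncated subtraction gives the ♯ cell 0.
  spaceTime : ℕ → ℕ → State A
  spaceTime X Y = configAt A w X (suc Y ∸ X)

  spaceTime-diagonal : ∀ X → spaceTime X X ≡ configAt A w X 1
  spaceTime-diagonal X = cong (configAt A w X) (m+n∸n≡m 1 X)

  spaceTime-step : ∀ X Y → X ≤ Y → suc Y < n →
    spaceTime (suc X) (suc Y) ≡
    δ (configAt A w X (Y ∸ X)) (spaceTime X Y) (spaceTime X (suc Y))
  spaceTime-step X Y X≤Y Y<n = begin
    configAt A w (suc X) (suc Y ∸ X)
      ≡⟨ cong (configAt A w (suc X)) (+-∸-assoc 1 X≤Y) ⟩
    configAt A w (suc X) (suc (Y ∸ X))
      ≡⟨ configAt-step X (≤-trans (s<s (m∸n≤m Y X)) (<⇒≤ Y<n)) ⟩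
    δ (configAt A w X (Y ∸ X)) (configAt A w X (suc (Y ∸ X))) (configAt A w X (suc (suc (Y ∸ X))))
      ≡⟨ cong₂ (δ (configAt A w X (Y ∸ X)))
               (cong (configAt A w X) (sym (+-∸-assoc 1 X≤Y)))
               (cong (configAt A w X) (sym (+-∸-assoc 2 X≤Y))) ⟩
    δ (configAt A w X (Y ∸ X)) (spaceTime X Y) (spaceTime X (suc Y)) ∎
    where open ≡-Reasoning

  spaceTime-edge : ∀ {X Y} → X ≢ 0 → X ≡ Y → Y < n →
    spaceTime X Y ≡ δ sharp (spaceTime (X ∸ 1) (Y ∸ 1)) (spaceTime (X ∸ 1) Y)
  spaceTime-edge {zero}  X≢0 _    _   = contradiction refl X≢0
  spaceTime-edge {suc X} _   refl X<n = begin
    spaceTime (suc X) (suc X)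
      ≡⟨ spaceTime-step X X ≤-refl X<n ⟩
    δ (configAt A w X (X ∸ X)) (spaceTime X X) (spaceTime X (suc X))
      ≡⟨ cong (λ c → δ c (spaceTime X X) (spaceTime X (suc X)))
              (trans (cong (configAt A w X) (n∸n≡0 X)) (configAt-cell0 X)) ⟩
    δ sharp (spaceTime X X) (spaceTime X (suc X)) ∎
    where open ≡-Reasoning

  -- For Y = Y′ + 2 the left neighbour  configAt X (Y′ + 1 ∸ X)  is spaceTime X Y′ by definition.
  spaceTime-interior : ∀ {X Y} → X ≢ 0 → X < Y → Y < n →
    spaceTime X Y ≡
    δ (spaceTime (X ∸ 1) (Y ∸ 2)) (spaceTime (X ∸ 1) (Y ∸ 1)) (spaceTime (X ∸ 1) Y)
  spaceTime-interior {zero}                X≢0 _   _   = contradiction refl X≢0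
  spaceTime-interior {suc X} {suc zero}    _   (s≤s ()) _
  spaceTime-interior {suc X} {suc (suc Y)} _   X<Y Y<n = spaceTime-step X (suc Y) (≤-pred (<⇒≤ X<Y)) Y<n

module HornEncoding {k} (A : CA k) where
  open CA A

  r : ℕ
  r = 2 + (k + m)

  EQ LT : Fin r
  EQ = zero
  LT = suc zero

  ⟦_⟧ : State A → Fin r
  ⟦ q ⟧ = suc (suc (join k m q))

  states : List (State A)
  states = map (splitAt k) (allFin (k + m))

  ∈-states : ∀ q → q ∈ states
  ∈-states q = subst (_∈ states) (splitAt-join k m q) (∈-map⁺ (splitAt k) (∈-allFin (join k m q)))

  isMinᵃ notMinᵃ isMaxᵃ : Var → Atom k r
  isMinᵃ  v = bound true  umin v 0
  notMinᵃ v = bound false umin v 0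
  isMaxᵃ  v = bound true  umax v 0

  data Rule : Set where
    eq-base eq-step lt-base lt-step : Rule
    input    : Fin k → Rule
    reject   : State A → Rule
    edge     : State A → State A → Rule
    interior : State A → State A → State A → Rule

  clausesOf : Rule → List (Clause k r)
  clausesOf eq-base  = [ (isMinᵃ vx ∷ isMinᵃ vy ∷ []) ⇒ just EQ ]
  clausesOf eq-step  = [ (notMinᵃ vx ∷ notMinᵃ vy ∷ relXY EQ 1 1 ∷ []) ⇒ just EQ ]
  clausesOf lt-base  = [ (isMinᵃ vx ∷ notMinᵃ vy ∷ []) ⇒ just LT ]
  clausesOf lt-step  = [ (relXY LT 1 1 ∷ []) ⇒ just LT ]
  clausesOf (input s) = [ (isMinᵃ vx ∷ letter s vy 0 ∷ []) ⇒ just ⟦ inj₁ s ⟧ ]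
  clausesOf (reject q) =
    if accept q then [] else [ (isMaxᵃ vx ∷ isMaxᵃ vy ∷ relXY ⟦ q ⟧ 0 0 ∷ []) ⇒ nothing ]
  clausesOf (edge b c) =
    [ (notMinᵃ vx ∷ relXY EQ 0 0 ∷ relXY ⟦ b ⟧ 1 1 ∷ relXY ⟦ c ⟧ 1 0 ∷ []) ⇒ just ⟦ δ sharp b c ⟧ ]
  clausesOf (interior a b c) =
    [ (notMinᵃ vx ∷ relXY LT 0 0 ∷ relXY ⟦ a ⟧ 1 2 ∷ relXY ⟦ b ⟧ 1 1 ∷ relXY ⟦ c ⟧ 1 0 ∷ [])
      ⇒ just ⟦ δ a b c ⟧ ]

  rules : List Rule
  rules = eq-base ∷ eq-step ∷ lt-base ∷ lt-step ∷
          (map input (allFin k) ++ map reject states ++ cartesianProductWith edge states states ++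
           concatMap (λ a → cartesianProductWith (interior a) states states) states)

  ∈-rules : ∀ rule → rule ∈ rules
  ∈-rules eq-base = here refl
  ∈-rules eq-step = there (here refl)
  ∈-rules lt-base = there (there (here refl))
  ∈-rules lt-step = there (there (there (here refl)))
  ∈-rules (input s) = there (there (there (there (∈-++⁺ˡ (∈-map⁺ input (∈-allFin s))))))
  ∈-rules (reject q) = there (there (there (there
    (∈-++⁺ʳ (map input (allFin k)) (∈-++⁺ˡ (∈-map⁺ reject (∈-states q)))))))
  ∈-rules (edge b c) = there (there (there (there
    (∈-++⁺ʳ (map input (allFin k)) (∈-++⁺ʳ (map reject states)
      (∈-++⁺ˡ (∈-cartesianProductWith⁺ edge (∈-states b) (∈-states c))))))))
  ∈-rules (interior a b c) = there (there (there (there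
    (∈-++⁺ʳ (map input (allFin k)) (∈-++⁺ʳ (map reject states)
      (∈-++⁺ʳ (cartesianProductWith edge states states)
        (∈-concat⁺′ (∈-cartesianProductWith⁺ (interior a) (∈-states b) (∈-states c))
                    (∈-map⁺ (λ a → cartesianProductWith (interior a) states states) (∈-states a)))))))))

  Φ : PredHorn k
  Φ = record { nrel = r ; clauses = concatMap clausesOf rules }

  δ-cong : ∀ {a a′ b b′ c c′} → a ≡ a′ → b ≡ b′ → c ≡ c′ → δ a b c ≡ δ a′ b′ c′
  δ-cong refl refl refl = refl

  module Soundness {n} (w : Word k (suc n)) (accepted : AcceptsRT A w) where
    open SpaceTime A w

    Meaning : Fin r → ℕ → ℕ → Set
    Meaning zero              = _≡_
    Meaning (suc zero)        = _<_
    Meaning (suc (suc j)) X Y = X ≤ Y × spaceTime X Y ≡ splitAt k j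

    meaning? : ∀ S X Y → Dec (Meaning S X Y)
    meaning? zero              = _≟_
    meaning? (suc zero)        = _<?_
    meaning? (suc (suc j)) X Y = X ≤? Y ×-dec ≡-dec _≟ᶠ_ _≟ᶠ_ (spaceTime X Y) (splitAt k j)

    intended : Interp r (suc n)
    intended S x y = does (meaning? S (toℕ x) (toℕ y))

    accepting-corner : ∀ {q} → spaceTime n n ≡ q → accept q ≡ true
    accepting-corner refl = trans (cong accept (spaceTime-diagonal n)) accepted

    module _ (x y : Fin (suc n)) where
      intro : ∀ S → Meaning S (toℕ x) (toℕ y) → intended S x y ≡ true
      intro S = dec-true (meaning? S (toℕ x) (toℕ y))

      intro-state : ∀ q → toℕ x ≤ toℕ y → spaceTime (toℕ x) (toℕ y) ≡ q → intended ⟦ q ⟧ x y ≡ true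
      intro-state q x≤y reached = intro ⟦ q ⟧ (x≤y , trans reached (sym (splitAt-join k m q)))

      elim : ∀ S a b → intended S (x -ᵖ a) (y -ᵖ b) ≡ true → Meaning S (toℕ x ∸ a) (toℕ y ∸ b)
      elim S a b holds = subst₂ (Meaning S) (toℕ-[-ᵖ] x a) (toℕ-[-ᵖ] y b)
        (does⇒ (meaning? S (toℕ (x -ᵖ a)) (toℕ (y -ᵖ b))) holds)

      elim-state : ∀ q a b → intended ⟦ q ⟧ (x -ᵖ a) (y -ᵖ b) ≡ true →
        spaceTime (toℕ x ∸ a) (toℕ y ∸ b) ≡ q
      elim-state q a b holds = trans (proj₂ (elim ⟦ q ⟧ a b holds)) (splitAt-join k m q)

      rule-sound : ∀ rule → All (clauseSem w intended x y) (clausesOf rule)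
      rule-sound eq-base = (λ { (x≡0 ∷ y≡0 ∷ []) → intro EQ (trans x≡0 (sym y≡0)) }) ∷ []
      rule-sound eq-step =
        (λ { (x≢0 ∷ y≢0 ∷ eq ∷ []) → intro EQ (∸1-injective x≢0 y≢0 (elim EQ 1 1 eq)) }) ∷ []
      rule-sound lt-base =
        (λ { (x≡0 ∷ y≢0 ∷ []) → intro LT (subst (_< toℕ y) (sym x≡0) (n≢0⇒n>0 y≢0)) }) ∷ []
      rule-sound lt-step = (λ { (lt ∷ []) → intro LT (∸1-cancel-< (elim LT 1 1 lt)) }) ∷ []
      rule-sound (input s) = (λ { (x≡0 ∷ ys ∷ []) →
        intro-state (inj₁ s) (subst (_≤ toℕ y) (sym x≡0) z≤n)
          (trans (cong (λ X → spaceTime X (toℕ y)) x≡0) (trans (configAt-input y) (cong inj₁ ys))) }) ∷ []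
      rule-sound (reject q) with accept q in q-rejecting
      ... | true  = []
      ... | false = (λ { (x-last ∷ y-last ∷ reached ∷ []) →
        contradiction (trans (sym q-rejecting)
          (accepting-corner (subst₂ (λ X Y → spaceTime X Y ≡ q)
            (suc-injective x-last) (suc-injective y-last) (elim-state q 0 0 reached))))
          (λ ()) }) ∷ []
      rule-sound (edge b c) = (λ { (x≢0 ∷ eq ∷ hb ∷ hc ∷ []) →
        intro-state (δ sharp b c) (≤-reflexive (elim EQ 0 0 eq))
          (trans (spaceTime-edge x≢0 (elim EQ 0 0 eq) (toℕ<n y))
                 (cong₂ (δ sharp) (elim-state b 1 1 hb) (elim-state c 1 0 hc))) }) ∷ []
      rule-sound (interior a b c) = (λ { (x≢0 ∷ lt ∷ ha ∷ hb ∷ hc ∷ []) →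
        intro-state (δ a b c) (<⇒≤ (elim LT 0 0 lt))
          (trans (spaceTime-interior x≢0 (elim LT 0 0 lt) (toℕ<n y))
                 (δ-cong (elim-state a 1 2 ha) (elim-state b 1 1 hb) (elim-state c 1 0 hc))) }) ∷ []

    models : w ⊨ Φ
    models = intended , λ x y → concat⁺ (map⁺ {f = clausesOf} (universal (rule-sound x y) rules))

  module Completeness {n} (w : Word k (suc n)) (ρ : Interp r (suc n))
                      (model : ∀ x y → All (clauseSem w ρ x y) (PredHorn.clauses Φ)) where
    open SpaceTime A w

    rule-holds : ∀ x y rule → All (clauseSem w ρ x y) (clausesOf rule)
    rule-holds x y rule = lookup (map⁻ {f = clausesOf} (concat⁻ (model x y))) (∈-rules rule)

    suc⇒≢0 : ∀ {U X} → U ≡ suc X → U ≢ 0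
    suc⇒≢0 U≡1+X U≡0 = 0≢1+n (trans (sym U≡0) U≡1+X)

    eq-derived : ∀ X {x y} → toℕ x ≡ X → toℕ y ≡ X → ρ EQ x y ≡ true
    eq-derived zero    {x} {y} x≡0 y≡0 = head (rule-holds x y eq-base) (x≡0 ∷ y≡0 ∷ [])
    eq-derived (suc X) {x} {y} x≡X y≡X = head (rule-holds x y eq-step)
      (suc⇒≢0 x≡X ∷ suc⇒≢0 y≡X ∷ eq-derived X (toℕ-[-ᵖ]-≡ 1 x≡X) (toℕ-[-ᵖ]-≡ 1 y≡X) ∷ [])

    lt-derived : ∀ X {x y} → toℕ x ≡ X → X < toℕ y → ρ LT x y ≡ true
    lt-derived zero    {x} {y} x≡0 0<y = head (rule-holds x y lt-base) (x≡0 ∷ m<n⇒n≢0 0<y ∷ [])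
    lt-derived (suc X) {x} {y} x≡X X<y = head (rule-holds x y lt-step)
      (lt-derived X (toℕ-[-ᵖ]-≡ 1 x≡X) (subst (X <_) (sym (toℕ-[-ᵖ] y 1)) (∸-monoˡ-≤ 1 X<y)) ∷ [])

    diagram-derived : ∀ X {Y x y} → toℕ x ≡ X → toℕ y ≡ Y → X ≤ Y → ρ ⟦ spaceTime X Y ⟧ x y ≡ true
    diagram-derived zero {x = x} {y} x≡0 refl _ =
      subst (λ q → ρ ⟦ q ⟧ x y ≡ true) (sym (configAt-input y))
        (head (rule-holds x y (input (w y))) (x≡0 ∷ refl ∷ []))
    diagram-derived (suc X) {Y} {x} {y} x≡X y≡Y 1+X≤Y = derived (m≤n⇒m<n∨m≡n 1+X≤Y)
      where
        Y<n : Y < suc n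
        Y<n = subst (_< suc n) y≡Y (toℕ<n y)

        previous : ∀ b → X ≤ Y ∸ b → ρ ⟦ spaceTime X (Y ∸ b) ⟧ (x -ᵖ 1) (y -ᵖ b) ≡ true
        previous b = diagram-derived X (toℕ-[-ᵖ]-≡ 1 x≡X) (toℕ-[-ᵖ]-≡ b y≡Y)

        derived : suc X < Y ⊎ suc X ≡ Y → ρ ⟦ spaceTime (suc X) Y ⟧ x y ≡ true
        derived (inj₂ 1+X≡Y) =
          subst (λ q → ρ ⟦ q ⟧ x y ≡ true) (sym (spaceTime-edge (λ ()) 1+X≡Y Y<n))
            (head (rule-holds x y (edge _ _))
              (suc⇒≢0 x≡X ∷ eq-derived (suc X) x≡X (trans y≡Y (sym 1+X≡Y)) ∷
               previous 1 (∸-monoˡ-≤ 1 1+X≤Y) ∷ previous 0 (<⇒≤ 1+X≤Y) ∷ []))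
        derived (inj₁ 1+X<Y) =
          subst (λ q → ρ ⟦ q ⟧ x y ≡ true) (sym (spaceTime-interior (λ ()) 1+X<Y Y<n))
            (head (rule-holds x y (interior _ _ _))
              (suc⇒≢0 x≡X ∷ lt-derived (suc X) x≡X (subst (suc X <_) (sym y≡Y) 1+X<Y) ∷
               previous 2 (∸-monoˡ-≤ 2 1+X<Y) ∷ previous 1 (∸-monoˡ-≤ 1 1+X≤Y) ∷
               previous 0 (<⇒≤ 1+X≤Y) ∷ []))

    accepts : AcceptsRT A w
    accepts = subst (λ q → accept q ≡ true) (spaceTime-diagonal n) corner-accepting
      where
        last : Fin (suc n)
        last = fromℕ n
        last-isMax : isMax last
        last-isMax = cong suc (toℕ-fromℕ n)
        corner-accepting : accept (spaceTime n n) ≡ true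
        corner-accepting with accept (spaceTime n n) | rule-holds last last (reject (spaceTime n n))
        ... | true  | _        = refl
        ... | false | rejected = ⊥-elim (head rejected
          (last-isMax ∷ last-isMax ∷ diagram-derived n (toℕ-fromℕ n) (toℕ-fromℕ n) ≤-refl ∷ []))

lemma3 : (k : ℕ) (A : CA k) →
    Σ (PredHorn k) λ Φ →
      (n : ℕ) (w : Word k (suc n)) → (w ⊨ Φ) ⇔ AcceptsRT A w
lemma3 k A = HornEncoding.Φ A , λ n w →
  mk⇔ (λ (ρ , model) → HornEncoding.Completeness.accepts A w ρ model)
      (HornEncoding.Soundness.models A w)
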